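{- For every integer $n\ge 0$ and every list $L=(x_0,x_1,\dots,x_{n-1})$, the call $\mathrm{Permutations}(L,0,\mathrm{Func})$ invokes $\mathrm{Func}$ exactly $n!$ times, and the lists passed to $\mathrm{Func}$ are $(x_{\sigma(0)},x_{\sigma(1)},\dots,x_{\sigma(n-1)})$ where $\sigma$ ranges over all permutations of $\{0,1,\dots,n-1\}$, each permutation $\sigma$ occurring exactly once.
   Context: Lists are 0-indexed and mutable. $\mathrm{extract}(L,j)$ removes the element at position $j$ of $L$ and returns it; $\mathrm{Insert}(L,i,x)$ inserts $x$ into $L$ so that it occupies position $i$, shifting later elements one position to the right. The recursive procedure $\mathrm{Permutations}(L,i,\mathrm{Func})$ is: let $n$ be the length of $L$. If $i\ge n-1$, call $\mathrm{Func}(L)$. Otherwise: (1) call $\mathrm{Permutations}(L,i+1,\mathrm{Func})$; (2) do $\mathrm{Insert}(L,i,\mathrm{extract}(L,i+1))$ and call $\mathrm{Permutations}(L,i+1,\mathrm{Func})$; (3) repeat $\max(n-i-3,0)$ times: if $n-i$ is even do $\mathrm{Insert}(L,i,\mathrm{extract}(L,n-1))$, else do $\mathrm{Insert}(L,i,\mathrm{extract}(L,i+1))$, then call $\mathrm{Permutations}(L,i+1,\mathrm{Func})$; (4) if $n-i>2$, do $\mathrm{Insert}(L,i,\mathrm{extract}(L,i+1))$ and call $\mathrm{Permutations}(L,i+1,\mathrm{Func})$. The callback $\mathrm{Func}$ is assumed not to modify $L$. -}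

module Defs where

open import Level using (Level)
open import Data.Nat using (ℕ; zero; suc; _∸_; _≤?_; _%_; _≡ᵇ_; _<ᵇ_)
open import Data.Bool using (if_then_else_)
open import Data.Maybe using (Maybe; just; nothing)
open import Data.List using (List; []; _∷_; [_]; _++_; length; lookup)
open import Data.Product using (_×_; _,_; Σ)
open import Data.Fin using (Fin)
open import Data.Fin.Permutation using (Permutation′; _⟨$⟩ʳ_; _≈_)
open import Data.Vec as V using (Vec)
open import Relation.Nullary using (yes; no)
open import Relation.Binary.PropositionalEquality using (_≡_)

private variable
  a : Level
  A : Set a

at : List A → ℕ → Maybe A
at []       _       = nothing
at (x ∷ xs) zero    = just x
at (x ∷ xs) (suc j) = at xs j

removeAt : List A → ℕ → List A
removeAt []       _       = []
removeAt (x ∷ xs) zero    = xs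
removeAt (x ∷ xs) (suc j) = x ∷ removeAt xs j

insertAt : ℕ → A → List A → List A
insertAt zero    x xs       = x ∷ xs
insertAt (suc i) x []       = x ∷ []
insertAt (suc i) x (y ∷ xs) = y ∷ insertAt i x xs

-- Insert(L, i, extract(L, j))   (no-op if j is out of range; never happens in the algorithm)
move : ℕ → ℕ → List A → List A
move i j L with at L j
... | just x  = insertAt i x (removeAt L j)
... | nothing = L

-- A run of the procedure: (lists passed to Func, in call order ; final contents of L)
Run : Set a → Set a
Run A = List (List A) × List A

_>>>_ : Run A → (List A → Run A) → Run A
(outs , L) >>> g with g L
... | (outs′ , L′) = (outs ++ outs′ , L′)

repeatN : ℕ → (List A → Run A) → Run A → Run A
repeatN zero    g r = r
repeatN (suc m) g r = repeatN m g (r >>> g)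

-- Permutations(L, i, Func), with a structural fuel argument (the recursion
-- depth n - i is bounded by the fuel n given at the top-level call).
permsF : ℕ → ℕ → List A → Run A
permsF fuel i L with (length L ∸ 1) ≤? i
... | yes _ = ([ L ] , L)
... | no _ with fuel
...   | zero   = ([] , L)
...   | suc f  =
  let n   = length L
      rec = permsF f (suc i)
      j   = if ((n ∸ i) % 2 ≡ᵇ 0) then n ∸ 1 else suc i
      r1  = rec L
      r2  = r1 >>> (λ L′ → rec (move i (suc i) L′))
      r3  = repeatN (n ∸ i ∸ 3) (λ L′ → rec (move i j L′)) r2
  in if (2 <ᵇ (n ∸ i)) then r3 >>> (λ L′ → rec (move i (suc i) L′)) else r3

Permutations : List A → ℕ → Run A
Permutations L i = permsF (length L) i L

permuteBy : ∀ {n} → Vec A n → Permutation′ n → List A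
permuteBy xs σ = V.toList (V.tabulate (λ k → V.lookup xs (σ ⟨$⟩ʳ k)))

OccursOnce : ∀ {n} → Permutation′ n → List (Permutation′ n) → Set
OccursOnce σ σs =
  Σ (Fin (length σs)) (λ p → lookup σs p ≈ σ) ×
  (∀ p q → lookup σs p ≈ σ → lookup σs q ≈ σ → p ≡ q)

{-# OPTIONS --safe #-}
-- One level of the procedure makes m
-- calls from offset 1 on rearrangements L of its list, so its outputs are all
-- rearrangements, each once, as soon as the first entries of these m lists run
-- through the list.  Whether they do depends on how a level leaves its list, so
-- the induction also computes that final order: a swap of the first two entries
-- for odd m, finalOrderEven for even m.  For odd m the step between two calls is
-- conjugate to a rotation of the whole list, hence a single m-cycle; for even m
-- the inner calls only swap, and the rotations bring every entry but one to the
-- front.  The statement about vectors and Fin permutations follows by running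
-- the procedure on allFin n, since it commutes with relabelling the entries.
module Submission where

open import Defs
open import Level using (Level)
open import Function.Base using (_∘_; id)
open import Data.Bool using (Bool; true; false; if_then_else_; not)
open import Data.Bool.Properties using (if-float)
open import Data.Maybe as Maybe using (just; nothing; maybe′)
open import Data.Nat using (ℕ; zero; suc; _+_; _*_; _∸_; _!; _≤_; _≤?_; z≤n; s≤s; _%_; _≡ᵇ_; _<ᵇ_)
open import Data.Nat.Properties
  using (+-suc; +-∸-assoc; [m+n]∸[m+o]≡n∸o; m≤n+o⇒m∸n≤o; suc-injective)
open import Data.List
  using (List; []; _∷_; [_]; _++_; _∷ʳ_; length; map; reverse; concat; concatMap; take; iterate;
         _∷ʳ′_; initLast; tabulate; allFin; lookup)
open import Data.List.Properties
  using (map-++; length-map; ++-identityʳ; ++-assoc; unfold-reverse; ∷-injective; ∷ʳ-injective; ∷ʳ-++;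
         reverse-++; reverse-injective; length-reverse; reverse-involutive; concatMap-++;
         ∷-injectiveʳ; length-++; map-cong-local; length-tabulate; lookup-tabulate; map-tabulate; tabulate-cong)
import Data.Nat.GeneralisedArithmetic as ℕ
open import Data.List.Relation.Unary.All as All using (All; []; _∷_)
import Data.List.Relation.Unary.All.Properties as All
open import Data.Product as Prod using (_×_; _,_; proj₁; proj₂; Σ; ∃; ∃₂)
open import Data.Sum using (inj₁; inj₂)
open import Data.Empty using (⊥; ⊥-elim)
open import Data.Fin as Fin using (Fin; zero; suc; cast)
open import Data.Fin.Properties using (cast-involutive)
open import Data.Fin.Permutation as Perm using (Permutation′; _⟨$⟩ʳ_; _≈_; permutation)
open import Data.Vec as V using (Vec; toList)
import Data.Vec.Properties as VP
import Data.List.Membership.Setoid.Properties as ∈ₛ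
open import Axiom.UniquenessOfIdentityProofs using (module Decidable⇒UIP)
open import Relation.Nullary using (¬_; Dec; yes; no; contradiction)
open import Relation.Binary.PropositionalEquality
  using (_≡_; _≢_; refl; sym; trans; cong; cong₂; subst; setoid; module ≡-Reasoning)
open import Data.List.Relation.Unary.Any as Any using (here; there)
import Data.List.Relation.Unary.Any.Properties as Any
open import Data.List.Membership.Propositional using (_∈_)
import Data.List.Membership.Propositional.Properties as ∈
open import Data.List.Relation.Unary.Unique.Propositional using (Unique; []; _∷_)
import Data.List.Relation.Unary.Unique.Propositional.Properties as Unique
open import Data.List.Relation.Binary.Disjoint.Propositional using (Disjoint)
open import Data.List.Relation.Binary.Permutation.Propositional
  using (_↭_; ↭-refl; ↭-sym; ↭-trans; ↭-prep; ↭-swap; ↭⇒↭ₛ; module PermutationReasoning)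
import Data.List.Relation.Binary.Permutation.Setoid.Properties as ↭ₛ
import Data.List.Relation.Binary.Permutation.Propositional.Properties as ↭

private variable
  a b : Level
  A B : Set a

-- Lists and moves

swapFront : List A → List A
swapFront (x ∷ y ∷ L) = y ∷ x ∷ L
swapFront L           = L

swapFront-involutive : ∀ (L : List A) → swapFront (swapFront L) ≡ L
swapFront-involutive []          = refl
swapFront-involutive (x ∷ [])    = refl
swapFront-involutive (x ∷ y ∷ L) = refl

swapFront-↭ : ∀ (L : List A) → swapFront L ↭ L
swapFront-↭ []          = ↭-refl
swapFront-↭ (x ∷ [])    = ↭-refl
swapFront-↭ (x ∷ y ∷ L) = ↭-swap y x ↭-refl

lastToFront : List A → List A
lastToFront L = move 0 (length L ∸ 1) L

move-maybe : ∀ i j (L : List A) →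
  move i j L ≡ maybe′ (λ x → insertAt i x (removeAt L j)) L (at L j)
move-maybe i j L with at L j
... | just x  = refl
... | nothing = refl

move-∷ : ∀ i j (x : A) L → move (suc i) (suc j) (x ∷ L) ≡ x ∷ move i j L
move-∷ i j x L with at L j
... | just y  = refl
... | nothing = refl

move-0-1 : ∀ (L : List A) → move 0 1 L ≡ swapFront L
move-0-1 []          = refl
move-0-1 (x ∷ [])    = refl
move-0-1 (x ∷ y ∷ L) = refl

move-0-last : ∀ k (L : List A) → length L ≡ suc k → move 0 k L ≡ lastToFront L
move-0-last k L len = cong (λ n → move 0 (n ∸ 1) L) (sym len)

at-map : ∀ (h : A → B) L j → at (map h L) j ≡ Maybe.map h (at L j)
at-map h []      j       = refl
at-map h (x ∷ L) zero    = refl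
at-map h (x ∷ L) (suc j) = at-map h L j

removeAt-map : ∀ (h : A → B) L j → removeAt (map h L) j ≡ map h (removeAt L j)
removeAt-map h []      j       = refl
removeAt-map h (x ∷ L) zero    = refl
removeAt-map h (x ∷ L) (suc j) = cong (h x ∷_) (removeAt-map h L j)

insertAt-map : ∀ (h : A → B) i x L → insertAt i (h x) (map h L) ≡ map h (insertAt i x L)
insertAt-map h zero    x L       = refl
insertAt-map h (suc i) x []      = refl
insertAt-map h (suc i) x (y ∷ L) = cong (h y ∷_) (insertAt-map h i x L)

move-map : ∀ (h : A → B) i j L → move i j (map h L) ≡ map h (move i j L)
move-map h i j L
  rewrite move-maybe i j (map h L) | move-maybe i j L | at-map h L j | removeAt-map h L j
  with at L j
... | just x  = insertAt-map h i x (removeAt L j)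
... | nothing = refl

insertAt-↭ : ∀ i (x : A) L → insertAt i x L ↭ x ∷ L
insertAt-↭ zero    x L       = ↭-refl
insertAt-↭ (suc i) x []      = ↭-refl
insertAt-↭ (suc i) x (y ∷ L) = ↭-trans (↭-prep y (insertAt-↭ i x L)) (↭-swap y x ↭-refl)

lastToFront-∷ʳ : ∀ (X : List A) z → lastToFront (X ∷ʳ z) ≡ z ∷ X
lastToFront-∷ʳ X z = begin
    move 0 (length (X ∷ʳ z) ∸ 1) (X ∷ʳ z)
  ≡⟨ cong (λ j → move 0 j (X ∷ʳ z)) (length-∷ʳ-pred X) ⟩
    move 0 (length X) (X ∷ʳ z)
  ≡⟨ move-maybe 0 (length X) (X ∷ʳ z) ⟩
    maybe′ (λ x → x ∷ removeAt (X ∷ʳ z) (length X)) (X ∷ʳ z) (at (X ∷ʳ z) (length X))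
  ≡⟨ cong₂ (λ m R → maybe′ (_∷ R) (X ∷ʳ z) m) (at-length X) (removeAt-length X) ⟩
    z ∷ X ∎
  where
  open ≡-Reasoning
  length-∷ʳ-pred : ∀ X → length (X ∷ʳ z) ∸ 1 ≡ length X
  length-∷ʳ-pred []          = refl
  length-∷ʳ-pred (x ∷ [])    = refl
  length-∷ʳ-pred (x ∷ y ∷ X) = cong suc (length-∷ʳ-pred (y ∷ X))
  at-length : ∀ X → at (X ∷ʳ z) (length X) ≡ just z
  at-length []      = refl
  at-length (x ∷ X) = at-length X
  removeAt-length : ∀ X → removeAt (X ∷ʳ z) (length X) ≡ X
  removeAt-length []      = refl
  removeAt-length (x ∷ X) = cong (x ∷_) (removeAt-length X)

lastToFront-↭ : ∀ (L : List A) → lastToFront L ↭ L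
lastToFront-↭ L with initLast L
... | []       = ↭-refl
... | X ∷ʳ′ z  = subst (_↭ X ∷ʳ z) (sym (lastToFront-∷ʳ X z)) (↭.∷↭∷ʳ z X)

lastToFront-∷ : ∀ (h : A) X {y X′} → X ≢ [] → lastToFront X ≡ y ∷ X′ →
  lastToFront (h ∷ X) ≡ y ∷ h ∷ X′
lastToFront-∷ h X X≢[] eq with initLast X
... | []       = contradiction refl X≢[]
... | X″ ∷ʳ′ z with trans (sym (lastToFront-∷ʳ X″ z)) eq
...   | refl = lastToFront-∷ʳ (h ∷ X″) z

heads : List (List A) → List A
heads = concatMap (take 1)

mapTail : (List A → List A) → List A → List A
mapTail f []      = []
mapTail f (x ∷ L) = x ∷ f L

heads-map-mapTail : ∀ (f : List A → List A) Ls → heads (map (mapTail f) Ls) ≡ heads Ls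
heads-map-mapTail f []            = refl
heads-map-mapTail f ([] ∷ Ls)     = heads-map-mapTail f Ls
heads-map-mapTail f ((x ∷ L) ∷ Ls) = cong (x ∷_) (heads-map-mapTail f Ls)

mapTail-↭ : ∀ {f : List A → List A} → (∀ L → f L ↭ L) → ∀ L → mapTail f L ↭ L
mapTail-↭ f-↭ []      = ↭-refl
mapTail-↭ f-↭ (x ∷ L) = ↭-prep x (f-↭ L)

mapTail-injective : ∀ {f : List A → List A} →
  (∀ {L L′} → length L ≡ length L′ → f L ≡ f L′ → L ≡ L′) →
  ∀ {L L′} → length L ≡ length L′ → mapTail f L ≡ mapTail f L′ → L ≡ L′
mapTail-injective f-inj {[]}    {[]}     _   _  = refl
mapTail-injective f-inj {x ∷ L} {x′ ∷ L′} len eq with ∷-injective eq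
... | refl , eq′ = cong (x ∷_) (f-inj (suc-injective len) eq′)

lastToFront-insert : ∀ (x a b : A) R → lastToFront (a ∷ x ∷ b ∷ R) ≡ mapTail (insertAt 1 x) (lastToFront (a ∷ b ∷ R))
lastToFront-insert x a b R with initLast R
... | []       = refl
... | R′ ∷ʳ′ z =
  trans (lastToFront-∷ʳ (a ∷ x ∷ b ∷ R′) z) (cong (mapTail (insertAt 1 x)) (sym (lastToFront-∷ʳ (a ∷ b ∷ R′) z)))

lastToFront-++-reverse : ∀ (Z : List A) v V → lastToFront (Z ++ reverse (v ∷ V)) ≡ v ∷ Z ++ reverse V
lastToFront-++-reverse Z v V = begin
    lastToFront (Z ++ reverse (v ∷ V))
  ≡⟨ cong (λ R → lastToFront (Z ++ R)) (unfold-reverse v V) ⟩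
    lastToFront (Z ++ reverse V ∷ʳ v)
  ≡⟨ cong lastToFront (++-assoc Z (reverse V) [ v ]) ⟨
    lastToFront ((Z ++ reverse V) ∷ʳ v)
  ≡⟨ lastToFront-∷ʳ (Z ++ reverse V) v ⟩
    v ∷ Z ++ reverse V ∎
  where open ≡-Reasoning

lastToFront-power : ∀ (Z : List A) V → ℕ.iterate lastToFront (Z ++ reverse V) (length V) ≡ reverse V ++ Z
lastToFront-power Z []      = ++-identityʳ Z
lastToFront-power Z (v ∷ V) = begin
    ℕ.iterate lastToFront (lastToFront (Z ++ reverse (v ∷ V))) (length V)
  ≡⟨ cong (λ R → ℕ.iterate lastToFront R (length V)) (lastToFront-++-reverse Z v V) ⟩
    ℕ.iterate lastToFront ((v ∷ Z) ++ reverse V) (length V)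
  ≡⟨ lastToFront-power (v ∷ Z) V ⟩
    reverse V ++ v ∷ Z
  ≡⟨ ++-assoc (reverse V) [ v ] Z ⟨
    (reverse V ∷ʳ v) ++ Z
  ≡⟨ cong (_++ Z) (unfold-reverse v V) ⟨
    reverse (v ∷ V) ++ Z ∎
  where open ≡-Reasoning

lastToFront-power′ : ∀ (Z X : List A) → ℕ.iterate lastToFront (Z ++ X) (length X) ≡ X ++ Z
lastToFront-power′ Z X = begin
    ℕ.iterate lastToFront (Z ++ X) (length X)
  ≡⟨ cong₂ (λ Y n → ℕ.iterate lastToFront (Z ++ Y) n) (reverse-involutive X) (length-reverse X) ⟨
    ℕ.iterate lastToFront (Z ++ reverse (reverse X)) (length (reverse X))
  ≡⟨ lastToFront-power Z (reverse X) ⟩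
    reverse (reverse X) ++ Z
  ≡⟨ cong (_++ Z) (reverse-involutive X) ⟩
    X ++ Z ∎
  where open ≡-Reasoning

lastToFront-cycle : ∀ (X : List A) → ℕ.iterate lastToFront X (length X) ≡ X
lastToFront-cycle X = trans (lastToFront-power′ [] X) (++-identityʳ X)

heads-lastToFront : ∀ (z : A) Z V →
  heads (iterate lastToFront (z ∷ Z ++ reverse V) (suc (length V))) ≡ z ∷ V
heads-lastToFront z Z []      = refl
heads-lastToFront z Z (v ∷ V) =
  cong (z ∷_) (trans (cong (λ R → heads (iterate lastToFront R (suc (length V)))) (lastToFront-++-reverse (z ∷ Z) v V))
                     (heads-lastToFront v (z ∷ Z) V))

heads-lastToFront′ : ∀ (z : A) Z X → heads (iterate lastToFront (z ∷ Z ++ X) (suc (length X))) ≡ z ∷ reverse X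
heads-lastToFront′ z Z X = begin
    heads (iterate lastToFront (z ∷ Z ++ X) (suc (length X)))
  ≡⟨ cong₂ (λ Y n → heads (iterate lastToFront (z ∷ Z ++ Y) (suc n))) (reverse-involutive X) (length-reverse X) ⟨
    heads (iterate lastToFront (z ∷ Z ++ reverse (reverse X)) (suc (length (reverse X))))
  ≡⟨ heads-lastToFront z Z (reverse X) ⟩
    z ∷ reverse X ∎
  where open ≡-Reasoning

++-injective : ∀ (xs ys : List A) {zs ws} → length xs ≡ length ys → xs ++ zs ≡ ys ++ ws → xs ≡ ys × zs ≡ ws
++-injective []       []       _   eq = refl , eq
++-injective (x ∷ xs) (y ∷ ys) len eq with ∷-injective eq
... | refl , eq′ with ++-injective xs ys (suc-injective len) eq′
...   | refl , refl = refl , refl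

power-suc : ∀ (f : A → A) x n → ℕ.iterate f x (suc n) ≡ f (ℕ.iterate f x n)
power-suc f x zero    = refl
power-suc f x (suc n) = power-suc f (f x) n

module Iteration {P : A → Set b} {f : A → A} (f-pres : ∀ {x} → P x → P (f x)) where

  iterate-All : ∀ {x} n → P x → All P (iterate f x n)
  iterate-All zero    px = []
  iterate-All (suc n) px = px ∷ iterate-All n (f-pres px)

  power-pres : ∀ {x} n → P x → P (ℕ.iterate f x n)
  power-pres zero    px = px
  power-pres (suc n) px = power-pres n (f-pres px)

  module Conjugation {g : B → B} {K : A → B} (K-conj : ∀ {x} → P x → K (f x) ≡ g (K x)) where

    map-iterate-conj : ∀ {x} n → P x → map K (iterate f x n) ≡ iterate g (K x) n
    map-iterate-conj zero    px = refl
    map-iterate-conj {x} (suc n) px =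
      cong (K x ∷_) (trans (map-iterate-conj n (f-pres px)) (cong (λ y → iterate g y n) (K-conj px)))

    power-conj : ∀ {x} n → P x → K (ℕ.iterate f x n) ≡ ℕ.iterate g (K x) n
    power-conj zero    px = refl
    power-conj (suc n) px = trans (power-conj n (f-pres px)) (cong (λ y → ℕ.iterate g y n) (K-conj px))

-- Runs of the procedure

mapRun : (List A → List B) → Run A → Run B
mapRun F (outs , L) = map F outs , F L

>>>-def : (r : Run A) (g : List A → Run A) →
  r >>> g ≡ (proj₁ r ++ proj₁ (g (proj₂ r)) , proj₂ (g (proj₂ r)))
>>>-def (outs , L) g with g L
... | outs′ , L′ = refl

Commutes : (List A → List B) → (List A → Run A) → (List B → Run B) → Set _
Commutes F g g′ = ∀ L → g′ (F L) ≡ mapRun F (g L)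

>>>-natural : ∀ {F : List A → List B} {g g′} → Commutes F g g′ →
  ∀ r → mapRun F r >>> g′ ≡ mapRun F (r >>> g)
>>>-natural {F = F} {g} {g′} comm (outs , L)
  rewrite >>>-def (map F outs , F L) g′ | >>>-def (outs , L) g | comm L
  = cong (_, _) (sym (map-++ F outs (proj₁ (g L))))

repeatN-natural : ∀ {F : List A → List B} {g g′} → Commutes F g g′ →
  ∀ k r → repeatN k g′ (mapRun F r) ≡ mapRun F (repeatN k g r)
repeatN-natural comm zero    r = refl
repeatN-natural {g = g} {g′} comm (suc k) r =
  trans (cong (repeatN k g′) (>>>-natural {g = g} {g′} comm r)) (repeatN-natural comm k (r >>> g))

closeWith : ℕ → (List A → Run A) → Run A → Run A
closeWith m s r = if 2 <ᵇ m then r >>> s else r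

closeWith-natural : ∀ {F : List A → List B} {s s′} → Commutes F s s′ →
  ∀ m r → closeWith m s′ (mapRun F r) ≡ mapRun F (closeWith m s r)
closeWith-natural {s = s} {s′} comm m r with 2 <ᵇ m
... | true  = >>>-natural {g = s} {s′} comm r
... | false = refl

-- One level of Permutations(L, i, Func) on a suffix of length m: rec is the
-- recursive call, s is steps (2) and (4) and t is step (3), each a move then rec.
sweepBody : ℕ → (List A → Run A) → (List A → Run A) → (List A → Run A) → List A → Run A
sweepBody m rec s t L = closeWith m s (repeatN (m ∸ 3) t (rec L >>> s))

sweepBody-natural : ∀ {F : List A → List B} {rec rec′ s s′ t t′} m →
  Commutes F rec rec′ → Commutes F s s′ → Commutes F t t′ →
  Commutes F (sweepBody m rec s t) (sweepBody m rec′ s′ t′)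
sweepBody-natural {F = F} {rec} {rec′} {s} {s′} {t} {t′} m c-rec c-s c-t L = begin
    closeWith m s′ (repeatN (m ∸ 3) t′ (rec′ (F L) >>> s′))
  ≡⟨ cong (λ r → closeWith m s′ (repeatN (m ∸ 3) t′ (r >>> s′))) (c-rec L) ⟩
    closeWith m s′ (repeatN (m ∸ 3) t′ (mapRun F (rec L) >>> s′))
  ≡⟨ cong (λ r → closeWith m s′ (repeatN (m ∸ 3) t′ r)) (>>>-natural {g = s} {s′} c-s (rec L)) ⟩
    closeWith m s′ (repeatN (m ∸ 3) t′ (mapRun F (rec L >>> s)))
  ≡⟨ cong (closeWith m s′) (repeatN-natural {g = t} {t′} c-t (m ∸ 3) (rec L >>> s)) ⟩
    closeWith m s′ (mapRun F (repeatN (m ∸ 3) t (rec L >>> s)))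
  ≡⟨ closeWith-natural {s = s} {s′} c-s m _ ⟩
    mapRun F (sweepBody m rec s t L) ∎
  where open ≡-Reasoning

repeatN-snoc : ∀ k (g : List A → Run A) r → repeatN k g r >>> g ≡ repeatN (suc k) g r
repeatN-snoc zero    g r = refl
repeatN-snoc (suc k) g r = repeatN-snoc k g (r >>> g)

module _ (rec : List A → Run A) (mv : List A → List A) where

  advance : List A → List A
  advance = mv ∘ proj₂ ∘ rec

  repeatN-iterate : ∀ k outs L →
    repeatN k (rec ∘ mv) (outs , proj₂ (rec L)) ≡
      (outs ++ concatMap (proj₁ ∘ rec) (iterate advance (advance L) k) , proj₂ (rec (ℕ.iterate advance L k)))
  repeatN-iterate zero    outs L = cong (_, proj₂ (rec L)) (sym (++-identityʳ outs))
  repeatN-iterate (suc k) outs L = begin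
      repeatN k (rec ∘ mv) ((outs , proj₂ (rec L)) >>> (rec ∘ mv))
    ≡⟨ cong (repeatN k (rec ∘ mv)) (>>>-def (outs , proj₂ (rec L)) (rec ∘ mv)) ⟩
      repeatN k (rec ∘ mv) (outs ++ proj₁ (rec (advance L)) , proj₂ (rec (advance L)))
    ≡⟨ repeatN-iterate k (outs ++ proj₁ (rec (advance L))) (advance L) ⟩
      ((outs ++ proj₁ (rec (advance L))) ++ concatMap (proj₁ ∘ rec) (iterate advance (advance (advance L)) k) ,
       proj₂ (rec (ℕ.iterate advance (advance L) k)))
    ≡⟨ cong (_, _) (++-assoc outs _ _) ⟩
      (outs ++ concatMap (proj₁ ∘ rec) (iterate advance (advance L) (suc k)) ,
       proj₂ (rec (ℕ.iterate advance L (suc k)))) ∎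
    where open ≡-Reasoning

moveSource : ℕ → ℕ → ℕ
moveSource n i = if (n ∸ i) % 2 ≡ᵇ 0 then n ∸ 1 else suc i

permsF-done : ∀ f i (L : List A) → length L ∸ 1 ≤ i → permsF f i L ≡ ([ L ] , L)
permsF-done f i L done with length L ∸ 1 ≤? i
... | yes _       = refl
... | no notDone = contradiction done notDone

permsF-noFuel : ∀ i (L : List A) → ¬ (length L ∸ 1 ≤ i) → permsF 0 i L ≡ ([] , L)
permsF-noFuel i L notDone with length L ∸ 1 ≤? i
... | yes done = contradiction done notDone
... | no _     = refl

permsF-step : ∀ f i (L : List A) → ¬ (length L ∸ 1 ≤ i) →
  permsF (suc f) i L ≡
    sweepBody (length L ∸ i) (permsF f (suc i)) (permsF f (suc i) ∘ move i (suc i))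
              (permsF f (suc i) ∘ move i (moveSource (length L) i)) L
permsF-step f i L notDone with length L ∸ 1 ≤? i
... | yes done = contradiction done notDone
... | no _     = refl

m∸1≤n⇒m≤1+n : ∀ m n → m ∸ 1 ≤ n → m ≤ suc n
m∸1≤n⇒m≤1+n zero    n _  = z≤n
m∸1≤n⇒m≤1+n (suc m) n le = s≤s le

o+m∸1≤o+n⇒m∸1≤n : ∀ o m n → (o + m) ∸ 1 ≤ o + n → m ∸ 1 ≤ n
o+m∸1≤o+n⇒m∸1≤n zero    m n le = le
o+m∸1≤o+n⇒m∸1≤n (suc o) m n le = o+m∸1≤o+n⇒m∸1≤n o m n (m≤n+o⇒m∸n≤o (o + m) 1 le)

m∸1≤n⇒o+m∸1≤o+n : ∀ o m n → m ∸ 1 ≤ n → (o + m) ∸ 1 ≤ o + n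
m∸1≤n⇒o+m∸1≤o+n zero    m n le = le
m∸1≤n⇒o+m∸1≤o+n (suc o) m n le = m∸1≤n⇒m≤1+n (o + m) (o + n) (m∸1≤n⇒o+m∸1≤o+n o m n le)

moveSource-+ : ∀ d n i → 1 ≤ n → moveSource (d + n) (d + i) ≡ d + moveSource n i
moveSource-+ d n i 1≤n = begin
    moveSource (d + n) (d + i)
  ≡⟨ cong (λ k → if k % 2 ≡ᵇ 0 then d + n ∸ 1 else suc (d + i)) ([m+n]∸[m+o]≡n∸o d n i) ⟩
    (if (n ∸ i) % 2 ≡ᵇ 0 then d + n ∸ 1 else suc (d + i))
  ≡⟨ cong₂ (if (n ∸ i) % 2 ≡ᵇ 0 then_else_) (+-∸-assoc d 1≤n) (sym (+-suc d i)) ⟩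
    (if (n ∸ i) % 2 ≡ᵇ 0 then d + (n ∸ 1) else d + suc i)
  ≡⟨ if-float (d +_) ((n ∸ i) % 2 ≡ᵇ 0) ⟨
    d + moveSource n i ∎
  where open ≡-Reasoning

module _ (F : List A → List B) (d : ℕ)
         (length-F : ∀ L → length (F L) ≡ d + length L)
         (move-F : ∀ i j L → move (d + i) (d + j) (F L) ≡ F (move i j L)) where

  permsF-natural : ∀ f i L → permsF f (d + i) (F L) ≡ mapRun F (permsF f i L)
  permsF-natural f i L = byCases f (length L ∸ 1 ≤? i)
    where
    open ≡-Reasoning

    notDone′ : ¬ (length L ∸ 1 ≤ i) → ¬ (length (F L) ∸ 1 ≤ d + i)
    notDone′ notDone = notDone ∘ o+m∸1≤o+n⇒m∸1≤n d (length L) i ∘ subst (λ n → n ∸ 1 ≤ d + i) (length-F L)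

    byCases : ∀ f → Dec (length L ∸ 1 ≤ i) → permsF f (d + i) (F L) ≡ mapRun F (permsF f i L)
    byCases f (yes done) =
      trans (permsF-done f (d + i) (F L) done′) (cong (mapRun F) (sym (permsF-done f i L done)))
      where
      done′ : length (F L) ∸ 1 ≤ d + i
      done′ = subst (λ n → n ∸ 1 ≤ d + i) (sym (length-F L)) (m∸1≤n⇒o+m∸1≤o+n d (length L) i done)
    byCases zero (no notDone) =
      trans (permsF-noFuel (d + i) (F L) (notDone′ notDone)) (cong (mapRun F) (sym (permsF-noFuel i L notDone)))
    byCases (suc f′) (no notDone) = begin
        permsF (suc f′) (d + i) (F L)
      ≡⟨ permsF-step f′ (d + i) (F L) (notDone′ notDone) ⟩
        body (length (F L) ∸ (d + i)) (suc (d + i)) (moveSource (length (F L)) (d + i))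
      ≡⟨ shifted ⟩
        body (length L ∸ i) (d + suc i) (d + moveSource (length L) i)
      ≡⟨ sweepBody-natural {rec′ = permsF f′ (d + suc i)} {s′ = permsF f′ (d + suc i) ∘ move (d + i) (d + suc i)}
                           {t′ = permsF f′ (d + suc i) ∘ move (d + i) (d + moveSource (length L) i)}
                           (length L ∸ i) (permsF-natural f′ (suc i)) (step (suc i)) (step (moveSource (length L) i)) L ⟩
        mapRun F (sweepBody (length L ∸ i) (permsF f′ (suc i)) (permsF f′ (suc i) ∘ move i (suc i))
                            (permsF f′ (suc i) ∘ move i (moveSource (length L) i)) L)
      ≡⟨ cong (mapRun F) (permsF-step f′ i L notDone) ⟨
        mapRun F (permsF (suc f′) i L) ∎
      where
      body : ℕ → ℕ → ℕ → Run B
      body m k j = sweepBody m (permsF f′ k) (permsF f′ k ∘ move (d + i) k) (permsF f′ k ∘ move (d + i) j) (F L)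
      1≤n : 1 ≤ length L
      1≤n with length L
      ... | zero  = contradiction z≤n notDone
      ... | suc _ = s≤s z≤n
      shifted : body (length (F L) ∸ (d + i)) (suc (d + i)) (moveSource (length (F L)) (d + i))
              ≡ body (length L ∸ i) (d + suc i) (d + moveSource (length L) i)
      shifted = begin
          body (length (F L) ∸ (d + i)) (suc (d + i)) (moveSource (length (F L)) (d + i))
        ≡⟨ cong (λ n → body (n ∸ (d + i)) (suc (d + i)) (moveSource n (d + i))) (length-F L) ⟩
          body (d + length L ∸ (d + i)) (suc (d + i)) (moveSource (d + length L) (d + i))
        ≡⟨ cong₂ (λ m j → body m (suc (d + i)) j)
                 ([m+n]∸[m+o]≡n∸o d (length L) i) (moveSource-+ d (length L) i 1≤n) ⟩
          body (length L ∸ i) (suc (d + i)) (d + moveSource (length L) i)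
        ≡⟨ cong (λ k → body (length L ∸ i) k (d + moveSource (length L) i)) (+-suc d i) ⟨
          body (length L ∸ i) (d + suc i) (d + moveSource (length L) i) ∎
      step : ∀ j → Commutes F (permsF f′ (suc i) ∘ move i j) (permsF f′ (d + suc i) ∘ move (d + i) (d + j))
      step j L′ = trans (cong (permsF f′ (d + suc i)) (move-F i j L′)) (permsF-natural f′ (suc i) (move i j L′))

permsF-∷ : ∀ f i (x : A) L → permsF f (suc i) (x ∷ L) ≡ mapRun (x ∷_) (permsF f i L)
permsF-∷ f i x = permsF-natural (x ∷_) 1 (λ _ → refl) (λ i j L → move-∷ i j x L) f i

permsF-map : ∀ (h : A → B) f i L → permsF f i (map h L) ≡ mapRun (map h) (permsF f i L)
permsF-map h = permsF-natural (map h) 0 (length-map h) (move-map h)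

Permutations-map : ∀ (h : A → B) L → Permutations (map h L) 0 ≡ mapRun (map h) (Permutations L 0)
Permutations-map h L = trans (cong (λ f → permsF f 0 (map h L)) (length-map h L)) (permsF-map h (length L) 0 L)

-- Final orders

even? : ℕ → Bool
even? n = n % 2 ≡ᵇ 0

even?-suc : ∀ n → even? (suc n) ≡ not (even? n)
even?-suc zero          = refl
even?-suc (suc zero)    = refl
even?-suc (suc (suc n)) = even?-suc n

finalOrderEven : List A → List A
finalOrderEven (t₀ ∷ t₁ ∷ t₂ ∷ t₃ ∷ W) = t₁ ∷ swapFront (t₃ ∷ W ++ t₂ ∷ t₀ ∷ [])
finalOrderEven L                      = swapFront L

-- The order in which Permutations(L, 0) leaves a list L of length m.
finalOrder : ℕ → List A → List A
finalOrder m = if even? m then finalOrderEven else swapFront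

finalOrder-even : ∀ {m} (L : List A) → even? m ≡ true → finalOrder m L ≡ finalOrderEven L
finalOrder-even L ev = cong (λ b → (if b then finalOrderEven else swapFront) L) ev

finalOrder-odd : ∀ {m} (L : List A) → even? m ≡ false → finalOrder m L ≡ swapFront L
finalOrder-odd L od = cong (λ b → (if b then finalOrderEven else swapFront) L) od

finalOrderEven-↭ : ∀ (L : List A) → finalOrderEven L ↭ L
finalOrderEven-↭ (t₀ ∷ t₁ ∷ t₂ ∷ t₃ ∷ W) = begin
    t₁ ∷ swapFront (t₃ ∷ W ++ t₂ ∷ t₀ ∷ [])  ↭⟨ ↭-prep t₁ (swapFront-↭ (t₃ ∷ W ++ t₂ ∷ t₀ ∷ [])) ⟩
    t₁ ∷ (t₃ ∷ W) ++ t₂ ∷ t₀ ∷ []           ↭⟨ ↭-prep t₁ (↭.++-comm (t₃ ∷ W) (t₂ ∷ t₀ ∷ [])) ⟩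
    t₁ ∷ t₂ ∷ t₀ ∷ t₃ ∷ W                  ↭⟨ ↭-prep t₁ (↭-swap t₂ t₀ ↭-refl) ⟩
    t₁ ∷ t₀ ∷ t₂ ∷ t₃ ∷ W                  ↭⟨ ↭-swap t₁ t₀ ↭-refl ⟩
    t₀ ∷ t₁ ∷ t₂ ∷ t₃ ∷ W                  ∎
  where open PermutationReasoning
finalOrderEven-↭ []                   = ↭-refl
finalOrderEven-↭ (_ ∷ [])             = ↭-refl
finalOrderEven-↭ (x ∷ y ∷ [])         = swapFront-↭ (x ∷ y ∷ [])
finalOrderEven-↭ (x ∷ y ∷ z ∷ [])     = swapFront-↭ (x ∷ y ∷ z ∷ [])

evens odds : List A → List A
evens []      = []
evens (x ∷ W) = x ∷ odds W
odds []      = []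
odds (x ∷ W) = evens W

evens-odds-↭ : ∀ (W : List A) → evens W ++ odds W ↭ W
odds-evens-↭ : ∀ (W : List A) → odds W ++ evens W ↭ W
evens-odds-↭ []      = ↭-refl
evens-odds-↭ (x ∷ W) = ↭-prep x (odds-evens-↭ W)
odds-evens-↭ []      = ↭-refl
odds-evens-↭ (x ∷ W) = ↭-trans (↭.++-comm (evens W) (x ∷ odds W)) (↭-prep x (odds-evens-↭ W))

evens-odds-injective : ∀ {W W′ : List A} → evens W ≡ evens W′ → odds W ≡ odds W′ → W ≡ W′
evens-odds-injective {W = []}    {[]}     _  _  = refl
evens-odds-injective {W = x ∷ W} {x′ ∷ W′} eq₁ eq₂ with ∷-injective eq₁
... | refl , eq₃ = cong (x ∷_) (evens-odds-injective eq₂ eq₃)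

length-odds : ∀ {W W′ : List A} → length W ≡ length W′ → length (odds W) ≡ length (odds W′)
length-odds {W = []}          {[]}            _   = refl
length-odds {W = _ ∷ []}      {_ ∷ []}        _   = refl
length-odds {W = _ ∷ _ ∷ W}   {_ ∷ _ ∷ W′}    len =
  cong suc (length-odds {W = W} {W′} (suc-injective (suc-injective len)))

evens-++-pair : ∀ (W : List A) u v → even? (length W) ≡ true → evens (W ++ u ∷ v ∷ []) ≡ evens W ∷ʳ u
evens-++-pair []          u v _  = refl
evens-++-pair (x ∷ y ∷ W) u v ev = cong (x ∷_) (evens-++-pair W u v ev)

odds-++-pair : ∀ (W : List A) u v → even? (length W) ≡ true → odds (W ++ u ∷ v ∷ []) ≡ odds W ∷ʳ v
odds-++-pair []          u v _  = refl
odds-++-pair (x ∷ y ∷ W) u v ev = cong (y ∷_) (odds-++-pair W u v ev)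

cycleTail : List A → List A
cycleTail (t₁ ∷ t₂ ∷ t₃ ∷ W) = reverse (odds W) ++ t₃ ∷ t₂ ∷ reverse (evens W) ++ [ t₁ ]
cycleTail R                  = R

cycleTail-↭ : ∀ (R : List A) → cycleTail R ↭ R
cycleTail-↭ (t₁ ∷ t₂ ∷ t₃ ∷ W) = begin
    reverse (odds W) ++ t₃ ∷ t₂ ∷ reverse (evens W) ++ [ t₁ ]
  ↭⟨ ↭.++-comm (reverse (odds W)) _ ⟩
    t₃ ∷ t₂ ∷ (reverse (evens W) ++ [ t₁ ]) ++ reverse (odds W)
  ≡⟨ cong (λ X → t₃ ∷ t₂ ∷ X) (++-assoc (reverse (evens W)) [ t₁ ] (reverse (odds W))) ⟩
    t₃ ∷ t₂ ∷ reverse (evens W) ++ [ t₁ ] ++ reverse (odds W)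
  ↭⟨ ↭-prep t₃ (↭-prep t₂ (↭.shift t₁ (reverse (evens W)) (reverse (odds W)))) ⟩
    t₃ ∷ t₂ ∷ t₁ ∷ reverse (evens W) ++ reverse (odds W)
  ↭⟨ ↭-prep t₃ (↭-swap t₂ t₁ ↭-refl) ⟩
    t₃ ∷ t₁ ∷ t₂ ∷ reverse (evens W) ++ reverse (odds W)
  ↭⟨ ↭-swap t₃ t₁ ↭-refl ⟩
    t₁ ∷ t₃ ∷ t₂ ∷ reverse (evens W) ++ reverse (odds W)
  ↭⟨ ↭-prep t₁ (↭-swap t₃ t₂ ↭-refl) ⟩
    t₁ ∷ t₂ ∷ t₃ ∷ reverse (evens W) ++ reverse (odds W)
  ↭⟨ ↭-prep t₁ (↭-prep t₂ (↭-prep t₃ (↭.++⁺ (↭.↭-reverse (evens W)) (↭.↭-reverse (odds W))))) ⟩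
    t₁ ∷ t₂ ∷ t₃ ∷ evens W ++ odds W
  ↭⟨ ↭-prep t₁ (↭-prep t₂ (↭-prep t₃ (evens-odds-↭ W))) ⟩
    t₁ ∷ t₂ ∷ t₃ ∷ W ∎
  where open PermutationReasoning
cycleTail-↭ []          = ↭-refl
cycleTail-↭ (_ ∷ [])     = ↭-refl
cycleTail-↭ (_ ∷ _ ∷ []) = ↭-refl

cycleTail-injective : ∀ {R R′ : List A} → length R ≡ length R′ → cycleTail R ≡ cycleTail R′ → R ≡ R′
cycleTail-injective {R = []}          {[]}          _ eq = eq
cycleTail-injective {R = _ ∷ []}      {_ ∷ []}      _ eq = eq
cycleTail-injective {R = _ ∷ _ ∷ []}  {_ ∷ _ ∷ []}  _ eq = eq
cycleTail-injective {R = t₁ ∷ t₂ ∷ t₃ ∷ W} {t₁′ ∷ t₂′ ∷ t₃′ ∷ W′} len eq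
  with ++-injective (reverse (odds W)) (reverse (odds W′)) length-reversed-odds eq
  where
  length-reversed-odds : length (reverse (odds W)) ≡ length (reverse (odds W′))
  length-reversed-odds = trans (length-reverse (odds W))
    (trans (length-odds {W = W} {W′} (suc-injective (suc-injective (suc-injective len)))) (sym (length-reverse (odds W′))))
... | eq-odds , eq-rest with ∷-injective eq-rest
...   | refl , eq-rest′ with ∷-injective eq-rest′
...     | refl , eq-rest″ with ∷ʳ-injective (reverse (evens W)) (reverse (evens W′)) eq-rest″
...       | eq-evens , refl =
  cong (λ X → t₁ ∷ t₂ ∷ t₃ ∷ X) (evens-odds-injective (reverse-injective eq-evens) (reverse-injective eq-odds))

-- For T of even length, evenCycle T lists T along the cycle of finalOrderEven
-- (which is a single cycle), so that finalOrderEven becomes lastToFront.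
evenCycle : List A → List A
evenCycle = mapTail cycleTail

oddCycle : List A → List A
oddCycle = mapTail evenCycle

evenCycle-finalOrderEven : ∀ (T : List A) → even? (length T) ≡ true →
  evenCycle (finalOrderEven T) ≡ lastToFront (evenCycle T)
evenCycle-finalOrderEven []                    _ = refl
evenCycle-finalOrderEven (_ ∷ _ ∷ [])          _ = refl
evenCycle-finalOrderEven (_ ∷ _ ∷ _ ∷ _ ∷ [])  _ = refl
evenCycle-finalOrderEven (t₀ ∷ t₁ ∷ t₂ ∷ t₃ ∷ w₀ ∷ w₁ ∷ W) ev = begin
    t₁ ∷ reverse (odds (W ++ t₂ ∷ t₀ ∷ [])) ++ w₁ ∷ t₃ ∷ reverse (evens (W ++ t₂ ∷ t₀ ∷ [])) ++ [ w₀ ]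
  ≡⟨ cong₂ (λ O E → t₁ ∷ reverse O ++ w₁ ∷ t₃ ∷ reverse E ++ [ w₀ ])
           (odds-++-pair W t₂ t₀ ev) (evens-++-pair W t₂ t₀ ev) ⟩
    t₁ ∷ reverse (odds W ∷ʳ t₀) ++ w₁ ∷ t₃ ∷ reverse (evens W ∷ʳ t₂) ++ [ w₀ ]
  ≡⟨ cong₂ (λ O E → t₁ ∷ O ++ w₁ ∷ t₃ ∷ E ++ [ w₀ ])
           (reverse-++ (odds W) [ t₀ ]) (reverse-++ (evens W) [ t₂ ]) ⟩
    t₁ ∷ t₀ ∷ reverse (odds W) ++ w₁ ∷ t₃ ∷ t₂ ∷ reverse (evens W) ∷ʳ w₀
  ≡⟨ cong (λ X → t₁ ∷ t₀ ∷ X) (∷ʳ-++ (reverse (odds W)) w₁ _) ⟨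
    t₁ ∷ t₀ ∷ (reverse (odds W) ∷ʳ w₁) ++ t₃ ∷ t₂ ∷ reverse (evens W) ∷ʳ w₀
  ≡⟨ cong₂ (λ O E → t₁ ∷ t₀ ∷ O ++ t₃ ∷ t₂ ∷ E) (unfold-reverse w₁ (odds W)) (unfold-reverse w₀ (evens W)) ⟨
    t₁ ∷ t₀ ∷ reverse (w₁ ∷ odds W) ++ t₃ ∷ t₂ ∷ reverse (w₀ ∷ evens W)
  ≡⟨ lastToFront-∷ʳ (t₀ ∷ reverse (w₁ ∷ odds W) ++ t₃ ∷ t₂ ∷ reverse (w₀ ∷ evens W)) t₁ ⟨
    lastToFront ((t₀ ∷ reverse (w₁ ∷ odds W) ++ t₃ ∷ t₂ ∷ reverse (w₀ ∷ evens W)) ∷ʳ t₁)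
  ≡⟨ cong (λ X → lastToFront (t₀ ∷ X)) (++-assoc (reverse (w₁ ∷ odds W)) (t₃ ∷ t₂ ∷ reverse (w₀ ∷ evens W)) [ t₁ ]) ⟩
    lastToFront (evenCycle (t₀ ∷ t₁ ∷ t₂ ∷ t₃ ∷ w₀ ∷ w₁ ∷ W)) ∎
  where open ≡-Reasoning

oddCycle-swapFront : ∀ (x u : A) U V → evenCycle V ≡ lastToFront (evenCycle (u ∷ U)) →
  oddCycle (swapFront (x ∷ V)) ≡ lastToFront (oddCycle (x ∷ u ∷ U))
oddCycle-swapFront x u U []      eq with trans (cong length eq) (↭.↭-length (lastToFront-↭ (u ∷ cycleTail U)))
... | ()
oddCycle-swapFront x u U (v ∷ V) eq = sym (lastToFront-∷ x (u ∷ cycleTail U) (λ ()) (sym eq))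

oddCycle-↭ : ∀ (L : List A) → oddCycle L ↭ L
oddCycle-↭ = mapTail-↭ (mapTail-↭ cycleTail-↭)

oddCycle-injective : ∀ {L L′ : List A} → length L ≡ length L′ → oddCycle L ≡ oddCycle L′ → L ≡ L′
oddCycle-injective = mapTail-injective (mapTail-injective cycleTail-injective)

-- One level of the recursion

LeavesInFinalOrder : Set a → ℕ → Set a
LeavesInFinalOrder A k = ∀ (U : List A) → length U ≡ k → proj₂ (Permutations U 0) ≡ finalOrder k U

tail-length : ∀ {y : A} {U S k} → y ∷ U ↭ S → length S ≡ suc k → length U ≡ k
tail-length p len = suc-injective (trans (↭.↭-length p) len)

[]-↭ : ∀ {S : List A} {k} → [] ↭ S → length S ≡ suc k → ⊥
[]-↭ p len with trans (↭.↭-length p) len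
... | ()

-- Opaque, as unfolding the recursive call on partially known lists makes
-- conversion checking blow up.
opaque
  innerCall : ℕ → List A → Run A
  innerCall k = permsF k 1

  innerCall-∷ : ∀ k (y : A) U → length U ≡ k → innerCall k (y ∷ U) ≡ mapRun (y ∷_) (Permutations U 0)
  innerCall-∷ k y U len = trans (permsF-∷ k 0 y U) (cong (λ f → mapRun (y ∷_) (permsF f 0 U)) (sym len))

  Permutations-sweepBody : ∀ k (S : List A) → length S ≡ suc (suc k) →
    Permutations S 0 ≡ sweepBody (suc (suc k)) (innerCall (suc k)) (innerCall (suc k) ∘ move 0 1)
                                 (innerCall (suc k) ∘ move 0 (moveSource (suc (suc k)) 0)) S
  Permutations-sweepBody k S len = begin
      permsF (length S) 0 S
    ≡⟨ cong (λ f → permsF f 0 S) len ⟩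
      permsF (suc (suc k)) 0 S
    ≡⟨ permsF-step (suc k) 0 S notDone ⟩
      sweepBody (length S) (innerCall (suc k)) (innerCall (suc k) ∘ move 0 1)
                (innerCall (suc k) ∘ move 0 (moveSource (length S) 0)) S
    ≡⟨ cong (λ n → sweepBody n (innerCall (suc k)) (innerCall (suc k) ∘ move 0 1)
                             (innerCall (suc k) ∘ move 0 (moveSource n 0)) S) len ⟩
      sweepBody (suc (suc k)) (innerCall (suc k)) (innerCall (suc k) ∘ move 0 1)
                (innerCall (suc k) ∘ move 0 (moveSource (suc (suc k)) 0)) S ∎
    where
    open ≡-Reasoning
    notDone : ¬ (length S ∸ 1 ≤ 0)
    notDone le with subst (λ n → n ∸ 1 ≤ 0) len le
    ... | ()

record Sweep {A : Set a} (k : ℕ) (S : List A) : Set a where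
  field
    calls   : List (List A)
    run     : Permutations S 0 ≡ (concatMap (proj₁ ∘ innerCall k) calls , finalOrder (suc k) S)
    calls-↭ : All (_↭ S) calls
    heads-↭ : heads calls ↭ S

-- oddCycle conjugates the step G to lastToFront, so the heads of the calls run
-- through the list and G is a cycle of length k + 1.
module OddLevel {A : Set a} (k′ : ℕ) (ev : even? k′ ≡ true) (final-k : LeavesInFinalOrder A (suc (suc k′)))
                (x : A) (T : List A) (len : length (x ∷ T) ≡ suc (suc (suc k′))) where
  open ≡-Reasoning
  k : ℕ
  k = suc (suc k′)
  S : List A
  S = x ∷ T
  rec : List A → Run A
  rec = innerCall k
  G : List A → List A
  G = advance rec (move 0 1)

  odd : even? (suc k) ≡ false
  odd = trans (even?-suc k′) (cong not ev)

  G-∷ : ∀ y U → length U ≡ k → G (y ∷ U) ≡ swapFront (y ∷ finalOrderEven U)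
  G-∷ y U l = trans (move-0-1 (proj₂ (rec (y ∷ U)))) (cong swapFront (begin
      proj₂ (rec (y ∷ U))          ≡⟨ cong proj₂ (innerCall-∷ k y U l) ⟩
      y ∷ proj₂ (Permutations U 0) ≡⟨ cong (y ∷_) (final-k U l) ⟩
      y ∷ finalOrder k U           ≡⟨ cong (y ∷_) (finalOrder-even {m = k} U ev) ⟩
      y ∷ finalOrderEven U         ∎))

  G-↭ : ∀ {L} → L ↭ S → G L ↭ S
  G-↭ {[]}    p = ⊥-elim ([]-↭ p len)
  G-↭ {y ∷ U} p = subst (_↭ S) (sym (G-∷ y U (tail-length p len)))
                    (↭-trans (swapFront-↭ _) (↭-trans (↭-prep y (finalOrderEven-↭ U)) p))

  G-conj : ∀ {L} → L ↭ S → oddCycle (G L) ≡ lastToFront (oddCycle L)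
  G-conj {[]}        p = ⊥-elim ([]-↭ p len)
  G-conj {y ∷ []}    p with tail-length p len
  ... | ()
  G-conj {y ∷ u ∷ U} p = trans (cong oddCycle (G-∷ y (u ∷ U) l))
    (oddCycle-swapFront y u U (finalOrderEven (u ∷ U))
      (evenCycle-finalOrderEven (u ∷ U) (subst (λ n → even? n ≡ true) (sym l) ev)))
    where l = tail-length p len

  open Iteration {P = _↭ S} {f = G} G-↭
  open Conjugation {g = lastToFront} {K = oddCycle} G-conj

  G-cycle : ℕ.iterate G S (suc k) ≡ S
  G-cycle = oddCycle-injective (↭.↭-length (power-pres (suc k) ↭-refl)) (begin
      oddCycle (ℕ.iterate G S (suc k))                      ≡⟨ power-conj (suc k) ↭-refl ⟩
      ℕ.iterate lastToFront (oddCycle S) (suc k)            ≡⟨ cong (ℕ.iterate lastToFront (oddCycle S)) length-oddCycle ⟨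
      ℕ.iterate lastToFront (oddCycle S) (length (oddCycle S)) ≡⟨ lastToFront-cycle (oddCycle S) ⟩
      oddCycle S                                            ∎)
    where
    length-oddCycle : length (oddCycle S) ≡ suc k
    length-oddCycle = trans (↭.↭-length (oddCycle-↭ S)) len

  final : proj₂ (rec (ℕ.iterate G S k)) ≡ finalOrder (suc k) S
  final = begin
      proj₂ (rec (ℕ.iterate G S k))                      ≡⟨ swapFront-involutive _ ⟨
      swapFront (swapFront (proj₂ (rec (ℕ.iterate G S k)))) ≡⟨ cong swapFront (move-0-1 (proj₂ (rec (ℕ.iterate G S k)))) ⟨
      swapFront (G (ℕ.iterate G S k))                    ≡⟨ cong swapFront (power-suc G S k) ⟨
      swapFront (ℕ.iterate G S (suc k))                  ≡⟨ cong swapFront G-cycle ⟩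
      swapFront S                                        ≡⟨ finalOrder-odd {m = suc k} S odd ⟨
      finalOrder (suc k) S                               ∎

  run : Permutations S 0 ≡ (concatMap (proj₁ ∘ rec) (iterate G S (suc k)) , finalOrder (suc k) S)
  run = begin
      Permutations S 0
    ≡⟨ Permutations-sweepBody (suc k′) S len ⟩
      sweepBody (suc k) rec (rec ∘ move 0 1) (rec ∘ move 0 (moveSource (suc k) 0)) S
    ≡⟨ cong (λ j → sweepBody (suc k) rec (rec ∘ move 0 1) (rec ∘ move 0 j) S)
            (cong (λ b → if b then k else 1) odd) ⟩
      repeatN (suc k′) (rec ∘ move 0 1) (rec S) >>> (rec ∘ move 0 1)
    ≡⟨ repeatN-snoc (suc k′) (rec ∘ move 0 1) (rec S) ⟩
      repeatN k (rec ∘ move 0 1) (proj₁ (rec S) , proj₂ (rec S))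
    ≡⟨ repeatN-iterate rec (move 0 1) k (proj₁ (rec S)) S ⟩
      (concatMap (proj₁ ∘ rec) (iterate G S (suc k)) , proj₂ (rec (ℕ.iterate G S k)))
    ≡⟨ cong (concatMap (proj₁ ∘ rec) (iterate G S (suc k)) ,_) final ⟩
      (concatMap (proj₁ ∘ rec) (iterate G S (suc k)) , finalOrder (suc k) S) ∎

  heads-≡ : heads (iterate G S (suc k)) ≡ x ∷ reverse (evenCycle T)
  heads-≡ = begin
      heads (iterate G S (suc k))
    ≡⟨ heads-map-mapTail evenCycle (iterate G S (suc k)) ⟨
      heads (map oddCycle (iterate G S (suc k)))
    ≡⟨ cong heads (map-iterate-conj (suc k) ↭-refl) ⟩
      heads (iterate lastToFront (x ∷ evenCycle T) (suc k))
    ≡⟨ cong (λ n → heads (iterate lastToFront (x ∷ evenCycle T) (suc n))) length-evenCycle ⟨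
      heads (iterate lastToFront (x ∷ [] ++ evenCycle T) (suc (length (evenCycle T))))
    ≡⟨ heads-lastToFront′ x [] (evenCycle T) ⟩
      x ∷ reverse (evenCycle T) ∎
    where
    length-evenCycle : length (evenCycle T) ≡ k
    length-evenCycle = trans (↭.↭-length (mapTail-↭ cycleTail-↭ T)) (suc-injective len)

  heads-↭ : heads (iterate G S (suc k)) ↭ S
  heads-↭ = subst (_↭ S) (sym heads-≡) (↭-prep x (↭-trans (↭.↭-reverse (evenCycle T)) (mapTail-↭ cycleTail-↭ T)))

  sweep : Sweep k S
  sweep = record { calls = iterate G S (suc k) ; run = run ; calls-↭ = iterate-All (suc k) ↭-refl ; heads-↭ = heads-↭ }

-- After the first swap s₁ stays at position 2 while the other entries rotate, so
-- the heads of the calls are s₀, s₂, then s₃ ∷ W backwards, then s₁.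
module EvenLevel {A : Set a} (k₃ : ℕ) (odd : even? (suc (suc (suc k₃))) ≡ false)
                 (final-k : LeavesInFinalOrder A (suc (suc (suc k₃))))
                 (s₀ s₁ s₂ s₃ : A) (W : List A) (len : length (s₀ ∷ s₁ ∷ s₂ ∷ s₃ ∷ W) ≡ suc (suc (suc (suc k₃)))) where
  open ≡-Reasoning
  k : ℕ
  k = suc (suc (suc k₃))
  S Y₀ Y′ : List A
  S  = s₀ ∷ s₁ ∷ s₂ ∷ s₃ ∷ W
  Y₀ = s₂ ∷ s₀ ∷ s₃ ∷ W
  Y′ = (s₃ ∷ W) ++ s₂ ∷ s₀ ∷ []
  rec : List A → Run A
  rec = innerCall k
  G₁ G₂ K : List A → List A
  G₁ = advance rec (move 0 1)
  G₂ = advance rec (move 0 k)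
  K  = mapTail (insertAt 1 s₁)
  last : List A
  last = G₁ (ℕ.iterate G₂ (G₁ S) (suc k₃))
  calls : List (List A)
  calls = S ∷ iterate G₂ (G₁ S) (suc (suc k₃)) ++ [ last ]

  ev : even? (suc k) ≡ true
  ev = trans (even?-suc k) (cong not odd)
  length-W : length W ≡ k₃
  length-W = suc-injective (suc-injective (suc-injective (suc-injective len)))
  length-Y₀ : length Y₀ ≡ k
  length-Y₀ = cong (λ n → suc (suc (suc n))) length-W

  rec-final : ∀ y U → length U ≡ k → proj₂ (rec (y ∷ U)) ≡ y ∷ swapFront U
  rec-final y U l = begin
      proj₂ (rec (y ∷ U))          ≡⟨ cong proj₂ (innerCall-∷ k y U l) ⟩
      y ∷ proj₂ (Permutations U 0) ≡⟨ cong (y ∷_) (final-k U l) ⟩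
      y ∷ finalOrder k U           ≡⟨ cong (y ∷_) (finalOrder-odd {m = k} U odd) ⟩
      y ∷ swapFront U              ∎

  lastToFront-pres : ∀ {Y} → Y ↭ Y₀ → lastToFront Y ↭ Y₀
  lastToFront-pres q = ↭-trans (lastToFront-↭ _) q

  G₂-conj : ∀ {Y} → Y ↭ Y₀ → K (lastToFront Y) ≡ G₂ (K Y)
  G₂-conj {[]}     q with trans (↭.↭-length q) length-Y₀
  ... | ()
  G₂-conj {_ ∷ []} q with trans (↭.↭-length q) length-Y₀
  ... | ()
  G₂-conj {a ∷ b ∷ R} q = begin
      K (lastToFront (a ∷ b ∷ R))                ≡⟨ lastToFront-insert s₁ a b R ⟨
      lastToFront (a ∷ s₁ ∷ b ∷ R)               ≡⟨ move-0-last k (a ∷ s₁ ∷ b ∷ R) (cong suc l) ⟨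
      move 0 k (a ∷ s₁ ∷ b ∷ R)                  ≡⟨ cong (move 0 k) (rec-final a (b ∷ s₁ ∷ R) l) ⟨
      G₂ (K (a ∷ b ∷ R))                         ∎
    where l = trans (↭.↭-length q) length-Y₀

  open Iteration {P = _↭ Y₀} {f = lastToFront} lastToFront-pres
  open Conjugation {g = G₂} {K = K} G₂-conj

  Y₀-power : ℕ.iterate lastToFront Y₀ (suc k₃) ≡ Y′
  Y₀-power = trans (cong (ℕ.iterate lastToFront Y₀) (cong suc (sym length-W)))
                   (lastToFront-power′ (s₂ ∷ s₀ ∷ []) (s₃ ∷ W))

  Y′-↭ : Y′ ↭ Y₀
  Y′-↭ = subst (_↭ Y₀) Y₀-power (power-pres (suc k₃) ↭-refl)

  s₁∷Y₀-↭ : s₁ ∷ Y₀ ↭ S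
  s₁∷Y₀-↭ = ↭-trans (↭-prep s₁ (↭-swap s₂ s₀ ↭-refl)) (↭-swap s₁ s₀ ↭-refl)

  K-↭ : ∀ {Y} → Y ↭ Y₀ → K Y ↭ S
  K-↭ {[]}    q = ⊥-elim ([]-↭ q length-Y₀)
  K-↭ {a ∷ R} q = ↭-trans (insertAt-↭ 2 s₁ (a ∷ R)) (↭-trans (↭-prep s₁ q) s₁∷Y₀-↭)

  iterate-G₂ : ∀ n → iterate G₂ (G₁ S) n ≡ map K (iterate lastToFront Y₀ n)
  iterate-G₂ n = trans (cong (λ Z → iterate G₂ Z n) (cong (move 0 1) (rec-final s₀ (s₁ ∷ s₂ ∷ s₃ ∷ W) length-Y₀)))
    (sym (map-iterate-conj n ↭-refl))

  last-≡ : last ≡ s₁ ∷ Y′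
  last-≡ = begin
      G₁ (ℕ.iterate G₂ (G₁ S) (suc k₃))
    ≡⟨ cong (λ Z → G₁ (ℕ.iterate G₂ Z (suc k₃))) (cong (move 0 1) (rec-final s₀ (s₁ ∷ s₂ ∷ s₃ ∷ W) length-Y₀)) ⟩
      G₁ (ℕ.iterate G₂ (K Y₀) (suc k₃))
    ≡⟨ cong G₁ (power-conj (suc k₃) ↭-refl) ⟨
      G₁ (K (ℕ.iterate lastToFront Y₀ (suc k₃)))
    ≡⟨ cong (G₁ ∘ K) Y₀-power ⟩
      G₁ (K Y′)
    ≡⟨ G₁-K Y′ (trans (↭.↭-length Y′-↭) length-Y₀) ⟩
      s₁ ∷ Y′ ∎
    where
    G₁-K : ∀ Y → length Y ≡ k → G₁ (K Y) ≡ s₁ ∷ Y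
    G₁-K (a ∷ b ∷ R) l = cong (move 0 1) (rec-final a (b ∷ s₁ ∷ R) l)

  middle-↭ : All (_↭ S) (iterate G₂ (G₁ S) (suc (suc k₃)))
  middle-↭ = subst (All (_↭ S)) (sym (iterate-G₂ (suc (suc k₃))))
    (All.map⁺ (All.map K-↭ (iterate-All (suc (suc k₃)) ↭-refl)))

  last-↭ : last ↭ S
  last-↭ = subst (_↭ S) (sym last-≡) (↭-trans (↭-prep s₁ Y′-↭) s₁∷Y₀-↭)

  heads-≡ : heads calls ≡ s₀ ∷ (s₂ ∷ reverse (s₃ ∷ W)) ++ [ s₁ ]
  heads-≡ = cong (s₀ ∷_) (begin
      heads (iterate G₂ (G₁ S) (suc (suc k₃)) ++ [ last ])
    ≡⟨ concatMap-++ (take 1) (iterate G₂ (G₁ S) (suc (suc k₃))) [ last ] ⟩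
      heads (iterate G₂ (G₁ S) (suc (suc k₃))) ++ heads [ last ]
    ≡⟨ cong₂ (λ Ls L → heads Ls ++ heads [ L ]) (iterate-G₂ (suc (suc k₃))) last-≡ ⟩
      heads (map K (iterate lastToFront Y₀ (suc (suc k₃)))) ++ [ s₁ ]
    ≡⟨ cong (_++ [ s₁ ]) (heads-map-mapTail (insertAt 1 s₁) (iterate lastToFront Y₀ (suc (suc k₃)))) ⟩
      heads (iterate lastToFront Y₀ (suc (suc k₃))) ++ [ s₁ ]
    ≡⟨ cong (λ n → heads (iterate lastToFront Y₀ (suc (suc n))) ++ [ s₁ ]) length-W ⟨
      heads (iterate lastToFront (s₂ ∷ (s₀ ∷ []) ++ s₃ ∷ W) (suc (length (s₃ ∷ W)))) ++ [ s₁ ]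
    ≡⟨ cong (_++ [ s₁ ]) (heads-lastToFront′ s₂ (s₀ ∷ []) (s₃ ∷ W)) ⟩
      (s₂ ∷ reverse (s₃ ∷ W)) ++ [ s₁ ] ∎)

  run : Permutations S 0 ≡ (concatMap (proj₁ ∘ rec) calls , finalOrder (suc k) S)
  run = begin
      Permutations S 0
    ≡⟨ Permutations-sweepBody (suc (suc k₃)) S len ⟩
      sweepBody (suc k) rec (rec ∘ move 0 1) (rec ∘ move 0 (moveSource (suc k) 0)) S
    ≡⟨ cong (λ j → sweepBody (suc k) rec (rec ∘ move 0 1) (rec ∘ move 0 j) S)
            (cong (λ b → if b then k else 1) ev) ⟩
      repeatN (suc k₃) (rec ∘ move 0 k) (rec S >>> (rec ∘ move 0 1)) >>> (rec ∘ move 0 1)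
    ≡⟨ cong (λ r → repeatN (suc k₃) (rec ∘ move 0 k) r >>> (rec ∘ move 0 1)) (>>>-def (rec S) (rec ∘ move 0 1)) ⟩
      repeatN (suc k₃) (rec ∘ move 0 k) (o₀ ++ o₁ , proj₂ (rec (G₁ S))) >>> (rec ∘ move 0 1)
    ≡⟨ cong (_>>> (rec ∘ move 0 1)) (repeatN-iterate rec (move 0 k) (suc k₃) (o₀ ++ o₁) (G₁ S)) ⟩
      ((o₀ ++ o₁) ++ M , proj₂ (rec (ℕ.iterate G₂ (G₁ S) (suc k₃)))) >>> (rec ∘ move 0 1)
    ≡⟨ >>>-def ((o₀ ++ o₁) ++ M , proj₂ (rec (ℕ.iterate G₂ (G₁ S) (suc k₃)))) (rec ∘ move 0 1) ⟩
      (((o₀ ++ o₁) ++ M) ++ proj₁ (rec last) , proj₂ (rec last))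
    ≡⟨ cong₂ _,_ outputs-≡ final-≡ ⟩
      (concatMap (proj₁ ∘ rec) calls , finalOrder (suc k) S) ∎
    where
    o₀ o₁ M : List (List A)
    o₀ = proj₁ (rec S)
    o₁ = proj₁ (rec (G₁ S))
    M  = concatMap (proj₁ ∘ rec) (iterate G₂ (G₂ (G₁ S)) (suc k₃))
    outputs-≡ : ((o₀ ++ o₁) ++ M) ++ proj₁ (rec last) ≡ concatMap (proj₁ ∘ rec) calls
    outputs-≡ = begin
        ((o₀ ++ o₁) ++ M) ++ proj₁ (rec last)
      ≡⟨ cong (_++ proj₁ (rec last)) (++-assoc o₀ o₁ M) ⟩
        (o₀ ++ o₁ ++ M) ++ proj₁ (rec last)
      ≡⟨ ++-assoc o₀ (o₁ ++ M) (proj₁ (rec last)) ⟩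
        o₀ ++ (o₁ ++ M) ++ proj₁ (rec last)
      ≡⟨ cong (λ X → o₀ ++ (o₁ ++ M) ++ X) (++-identityʳ (proj₁ (rec last))) ⟨
        o₀ ++ (o₁ ++ M) ++ concatMap (proj₁ ∘ rec) [ last ]
      ≡⟨ cong (o₀ ++_) (concatMap-++ (proj₁ ∘ rec) (iterate G₂ (G₁ S) (suc (suc k₃))) [ last ]) ⟨
        concatMap (proj₁ ∘ rec) calls ∎
    final-≡ : proj₂ (rec last) ≡ finalOrder (suc k) S
    final-≡ = begin
        proj₂ (rec last)       ≡⟨ cong (proj₂ ∘ rec) last-≡ ⟩
        proj₂ (rec (s₁ ∷ Y′))  ≡⟨ rec-final s₁ Y′ (trans (↭.↭-length Y′-↭) length-Y₀) ⟩
        finalOrderEven S       ≡⟨ finalOrder-even {m = suc k} S ev ⟨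
        finalOrder (suc k) S   ∎

  heads-↭ : heads calls ↭ S
  heads-↭ = subst (_↭ S) (sym heads-≡) (↭-prep s₀ (↭-trans (↭-sym (↭.∷↭∷ʳ s₁ (s₂ ∷ reverse (s₃ ∷ W))))
                                                             (↭-prep s₁ (↭-prep s₂ (↭.↭-reverse (s₃ ∷ W))))))

  sweep : Sweep k S
  sweep = record { calls = calls ; run = run ; calls-↭ = ↭-refl ∷ All.++⁺ middle-↭ (last-↭ ∷ []) ; heads-↭ = heads-↭ }

sweep : ∀ k → LeavesInFinalOrder A k → ∀ (S : List A) → length S ≡ suc k → Sweep k S
sweep zero _ (x ∷ []) _ = record
  { calls   = (x ∷ []) ∷ []
  ; run     = cong (λ r → proj₁ r ++ [] , x ∷ []) (sym (innerCall-∷ 0 x [] refl))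
  ; calls-↭ = ↭-refl ∷ []
  ; heads-↭ = ↭-refl
  }
sweep (suc zero) _ (x ∷ y ∷ []) _ = record
  { calls   = (x ∷ y ∷ []) ∷ (y ∷ x ∷ []) ∷ []
  ; run     = cong₂ (λ r r′ → proj₁ r ++ proj₁ r′ ++ [] , y ∷ x ∷ [])
                    (sym (innerCall-∷ 1 x (y ∷ []) refl)) (sym (innerCall-∷ 1 y (x ∷ []) refl))
  ; calls-↭ = ↭-refl ∷ ↭-swap y x ↭-refl ∷ []
  ; heads-↭ = ↭-refl
  }
sweep (suc (suc zero)) final-k (x ∷ T) len = OddLevel.sweep 0 refl final-k x T len
sweep (suc (suc (suc k₃))) final-k (s₀ ∷ s₁ ∷ s₂ ∷ s₃ ∷ W) len = byParity (even? (suc k₃)) refl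
  where
  byParity : ∀ b → even? (suc k₃) ≡ b → Sweep (suc (suc (suc k₃))) (s₀ ∷ s₁ ∷ s₂ ∷ s₃ ∷ W)
  byParity true  ev  = OddLevel.sweep (suc k₃) ev final-k s₀ (s₁ ∷ s₂ ∷ s₃ ∷ W) len
  byParity false odd = EvenLevel.sweep k₃ odd final-k s₀ s₁ s₂ s₃ W len

Permutations-final : ∀ k → LeavesInFinalOrder A k
Permutations-final zero    []  _   = refl
Permutations-final (suc k) S   len = cong proj₂ (Sweep.run (sweep k (Permutations-final k) S len))

-- Lists of rearrangements

Unique-resp-↭ : ∀ {xs ys : List A} → xs ↭ ys → Unique xs → Unique ys
Unique-resp-↭ {A = A} p = ↭ₛ.Unique-resp-↭ (setoid A) (↭⇒↭ₛ p)

record Rearrangements {A : Set a} (S : List A) (Os : List (List A)) : Set a where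
  field
    sound    : All (_↭ S) Os
    complete : ∀ {P} → P ↭ S → P ∈ Os
    unique   : Unique S → Unique Os
    count    : length Os ≡ length S !

prefixed : (List A → List (List A)) → List A → List (List A)
prefixed O []      = []
prefixed O (y ∷ T) = map (y ∷_) (O T)

heads-∈ : ∀ {y : A} Ss → y ∈ heads Ss → ∃ λ T → y ∷ T ∈ Ss
heads-∈ ([] ∷ Ss)      y∈ = Prod.map₂ there (heads-∈ Ss y∈)
heads-∈ ((x ∷ T) ∷ Ss) (here refl) = T , here refl
heads-∈ ((x ∷ T) ∷ Ss) (there y∈)  = Prod.map₂ there (heads-∈ Ss y∈)

∈-concatMap-prefixed : ∀ (O : List A → List (List A)) Ss {v} → v ∈ concatMap (prefixed O) Ss →
  ∃₂ λ y P → v ≡ y ∷ P × y ∈ heads Ss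
∈-concatMap-prefixed O ([] ∷ Ss)      v∈ = ∈-concatMap-prefixed O Ss v∈
∈-concatMap-prefixed O ((x ∷ T) ∷ Ss) v∈ with ∈.∈-++⁻ (map (x ∷_) (O T)) v∈
... | inj₁ v∈block with ∈.∈-map⁻ (x ∷_) v∈block
...   | P , _ , eq = x , P , eq , here refl
∈-concatMap-prefixed O ((x ∷ T) ∷ Ss) v∈ | inj₂ v∈rest =
  Prod.map₂ (Prod.map₂ (Prod.map₂ there)) (∈-concatMap-prefixed O Ss v∈rest)

concatMap-prefixed : ∀ {k} {S : List A} (O : List A → List (List A)) Ss →
  length S ≡ suc k → All (_↭ S) Ss → heads Ss ↭ S →
  (∀ {y T} → y ∷ T ↭ S → Rearrangements T (O T)) →
  Rearrangements S (concatMap (prefixed O) Ss)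
concatMap-prefixed {k = k} {S} O Ss len Ss-↭ heads-↭ tails = record
  { sound    = sound Ss Ss-↭
  ; complete = complete
  ; unique   = λ uS → unique Ss (Unique-resp-↭ (↭-sym heads-↭) uS) (All.map (tail-unique uS) Ss-↭)
  ; count    = trans (count Ss Ss-↭) (trans (cong (_* k !) (trans (↭.↭-length heads-↭) len)) (cong _! (sym len)))
  }
  where
  sound : ∀ Ls → All (_↭ S) Ls → All (_↭ S) (concatMap (prefixed O) Ls)
  sound []             []          = []
  sound ([] ∷ Ls)      (_ ∷ ps)    = sound Ls ps
  sound ((y ∷ T) ∷ Ls) (yT↭S ∷ ps) =
    All.++⁺ (All.map⁺ (All.map (λ P↭T → ↭-trans (↭-prep y P↭T) yT↭S) (Rearrangements.sound (tails yT↭S))))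
            (sound Ls ps)

  complete : ∀ {P} → P ↭ S → P ∈ concatMap (prefixed O) Ss
  complete {[]}     P↭S = ⊥-elim ([]-↭ P↭S len)
  complete {p ∷ P′} P↭S with heads-∈ Ss (↭.∈-resp-↭ (↭-sym heads-↭) (↭.∈-resp-↭ P↭S (here refl)))
  ... | T , pT∈Ss = ∈.∈-concat⁺′ (∈.∈-map⁺ (p ∷_) (Rearrangements.complete (tails pT↭S) P′↭T))
                                 (∈.∈-map⁺ (prefixed O) pT∈Ss)
    where
    pT↭S : p ∷ T ↭ S
    pT↭S = All.lookup Ss-↭ pT∈Ss
    P′↭T : P′ ↭ T
    P′↭T = ↭.drop-∷ (↭-trans P↭S (↭-sym pT↭S))

  tail-unique : Unique S → ∀ {L} → L ↭ S → Unique (prefixed O L)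
  tail-unique uS {[]}    _    = []
  tail-unique uS {y ∷ T} yT↭S with Unique-resp-↭ (↭-sym yT↭S) uS
  ... | _ ∷ uT = Unique.map⁺ ∷-injectiveʳ (Rearrangements.unique (tails yT↭S) uT)

  unique : ∀ Ls → Unique (heads Ls) → All (Unique ∘ prefixed O) Ls → Unique (concatMap (prefixed O) Ls)
  unique []             _          _          = []
  unique ([] ∷ Ls)      u          (_ ∷ us)   = unique Ls u us
  unique ((y ∷ T) ∷ Ls) (y∉ ∷ u)   (uT ∷ us)  = Unique.++⁺ uT (unique Ls u us) disjoint
    where
    disjoint : Disjoint (map (y ∷_) (O T)) (concatMap (prefixed O) Ls)
    disjoint (v∈block , v∈rest) with ∈.∈-map⁻ (y ∷_) v∈block | ∈-concatMap-prefixed O Ls v∈rest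
    ... | _ , _ , refl | y′ , _ , refl , y′∈ = All.lookup y∉ y′∈ refl

  count : ∀ Ls → All (_↭ S) Ls → length (concatMap (prefixed O) Ls) ≡ length (heads Ls) * k !
  count []             []          = refl
  count ([] ∷ Ls)      (_ ∷ ps)    = count Ls ps
  count ((y ∷ T) ∷ Ls) (yT↭S ∷ ps) = begin
      length (map (y ∷_) (O T) ++ concatMap (prefixed O) Ls)
    ≡⟨ length-++ (map (y ∷_) (O T)) ⟩
      length (map (y ∷_) (O T)) + length (concatMap (prefixed O) Ls)
    ≡⟨ cong₂ _+_ (trans (length-map (y ∷_) (O T)) (Rearrangements.count (tails yT↭S))) (count Ls ps) ⟩
      length T ! + length (heads Ls) * k !
    ≡⟨ cong (λ n → n ! + length (heads Ls) * k !) (tail-length yT↭S len) ⟩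
      suc (length (heads Ls)) * k ! ∎
    where open ≡-Reasoning

Permutations-rearrangements : ∀ k (S : List A) → length S ≡ k → Rearrangements S (proj₁ (Permutations S 0))
Permutations-rearrangements zero [] _ = record
  { sound    = ↭-refl ∷ []
  ; complete = λ P↭[] → here (↭.↭-empty-inv P↭[])
  ; unique   = λ _ → [] ∷ []
  ; count    = refl
  }
Permutations-rearrangements (suc k) S len =
  subst (Rearrangements S) (sym outputs)
    (concatMap-prefixed outs calls len calls-↭ heads-↭
      (λ yT↭S → Permutations-rearrangements k _ (tail-length yT↭S len)))
  where
  open Sweep (sweep k (Permutations-final k) S len)
  outs : List A → List (List A)
  outs T = proj₁ (Permutations T 0)
  innerCall-outs : ∀ {L} → L ↭ S → proj₁ (innerCall k L) ≡ prefixed outs L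
  innerCall-outs {[]}    L↭S = ⊥-elim ([]-↭ L↭S len)
  innerCall-outs {y ∷ U} L↭S = cong proj₁ (innerCall-∷ k y U (tail-length L↭S len))
  outputs : proj₁ (Permutations S 0) ≡ concatMap (prefixed outs) calls
  outputs = trans (cong proj₁ run) (cong concat (map-cong-local (All.map innerCall-outs calls-↭)))

-- Permutations of Fin n

unique-⊆-↭ : ∀ {xs ys : List A} → Unique xs → (∀ {x} → x ∈ xs → x ∈ ys) → length xs ≡ length ys → xs ↭ ys
unique-⊆-↭ {xs = []}     {[]}    _         _   _   = ↭-refl
unique-⊆-↭ {xs = x ∷ xs} (x∉ ∷ u) ⊆ys len with ∈.∈-∃++ (⊆ys (here refl))
... | ys₁ , ys₂ , refl = ↭-trans (↭-prep x (unique-⊆-↭ u ⊆zs len′)) (↭-sym (↭.shift x ys₁ ys₂))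
  where
  ⊆zs : ∀ {z} → z ∈ xs → z ∈ ys₁ ++ ys₂
  ⊆zs z∈ with ↭.∈-resp-↭ (↭.shift x ys₁ ys₂) (⊆ys (there z∈))
  ... | here refl  = ⊥-elim (All.lookup x∉ z∈ refl)
  ... | there z∈zs = z∈zs
  len′ : length xs ≡ length (ys₁ ++ ys₂)
  len′ = suc-injective (trans len (↭.↭-length (↭.shift x ys₁ ys₂)))

tabulate-lookup-cast : ∀ {n} (o : List A) .(eq : n ≡ length o) → tabulate (lookup o ∘ cast eq) ≡ o
tabulate-lookup-cast {n = zero}  []      _  = refl
tabulate-lookup-cast {n = suc n} (x ∷ o) eq = cong (x ∷_) (tabulate-lookup-cast o (suc-injective eq))

index-∈-lookup : ∀ (o : List A) i → Any.index (∈.∈-lookup {xs = o} i) ≡ i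
index-∈-lookup (x ∷ o) zero    = refl
index-∈-lookup (x ∷ o) (suc i) = cong suc (index-∈-lookup o i)

toList-tabulate : ∀ {n} (f : Fin n → A) → V.toList (V.tabulate f) ≡ tabulate f
toList-tabulate {n = zero}  f = refl
toList-tabulate {n = suc n} f = cong (f zero ∷_) (toList-tabulate (f ∘ suc))

toList-allFin : ∀ {n} (xs : Vec A n) → V.toList xs ≡ map (V.lookup xs) (allFin n)
toList-allFin xs = trans (cong V.toList (sym (VP.tabulate∘lookup xs)))
  (trans (toList-tabulate (V.lookup xs)) (sym (map-tabulate id (V.lookup xs))))

module _ {n : ℕ} where

  word : Permutation′ n → List (Fin n)
  word σ = tabulate (σ ⟨$⟩ʳ_)

  word-↭ : ∀ σ → word σ ↭ allFin n
  word-↭ σ = unique-⊆-↭ (Unique.tabulate⁺ injective) (λ {x} _ → ∈.∈-allFin x)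
    (trans (length-tabulate (σ ⟨$⟩ʳ_)) (sym (length-tabulate id)))
    where
    injective : ∀ {i j} → σ ⟨$⟩ʳ i ≡ σ ⟨$⟩ʳ j → i ≡ j
    injective eq = trans (sym (Perm.inverseˡ σ)) (trans (cong (σ Perm.⟨$⟩ˡ_) eq) (Perm.inverseˡ σ))

  word-injective : ∀ {σ τ} → word σ ≡ word τ → σ ≈ τ
  word-injective {σ} {τ} eq k = begin
      σ ⟨$⟩ʳ k                                ≡⟨ lookup-tabulate (σ ⟨$⟩ʳ_) k ⟨
      lookup (word σ) (cast _ k)              ≡⟨ lookup-≡ eq ⟩
      lookup (word τ) (cast _ k)              ≡⟨ lookup-tabulate (τ ⟨$⟩ʳ_) k ⟩
      τ ⟨$⟩ʳ k                                ∎
    where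
    open ≡-Reasoning
    lookup-≡ : ∀ {xs ys : List (Fin n)} .{e₁ : n ≡ length xs} .{e₂ : n ≡ length ys} →
      xs ≡ ys → lookup xs (cast e₁ k) ≡ lookup ys (cast e₂ k)
    lookup-≡ refl = refl

  fromWord : (o : List (Fin n)) → o ↭ allFin n → Permutation′ n
  fromWord o o↭ = permutation to from to-from from-to
    where
    len : length o ≡ n
    len = trans (↭.↭-length o↭) (length-tabulate id)
    ∈o : ∀ x → x ∈ o
    ∈o x = ↭.∈-resp-↭ (↭-sym o↭) (∈.∈-allFin x)
    to from : Fin n → Fin n
    to k   = lookup o (cast (sym len) k)
    from x = cast len (Any.index (∈o x))
    to-from : ∀ x → to (from x) ≡ x
    to-from x = trans (cong (lookup o) (cast-involutive (sym len) len (Any.index (∈o x))))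
                      (sym (Any.lookup-index (∈o x)))
    from-to : ∀ k → from (to k) ≡ k
    from-to k = begin
        cast len (Any.index (∈o (lookup o (cast (sym len) k))))
      ≡⟨ cong (cast len ∘ Any.index) (∈ₛ.unique⇒irrelevant (setoid (Fin n)) (Decidable⇒UIP.≡-irrelevant Fin._≟_)
                                        (Unique-resp-↭ (↭-sym o↭) (Unique.allFin⁺ n)) _ (∈.∈-lookup (cast (sym len) k))) ⟩
        cast len (Any.index (∈.∈-lookup {xs = o} (cast (sym len) k)))
      ≡⟨ cong (cast len) (index-∈-lookup o (cast (sym len) k)) ⟩
        cast len (cast (sym len) k)
      ≡⟨ cast-involutive len (sym len) k ⟩
        k ∎
      where open ≡-Reasoning

  word-fromWord : ∀ o (o↭ : o ↭ allFin n) → word (fromWord o o↭) ≡ o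
  word-fromWord o o↭ = tabulate-lookup-cast o _

  fromWords : (O : List (List (Fin n))) → All (_↭ allFin n) O → List (Permutation′ n)
  fromWords []      []         = []
  fromWords (o ∷ O) (o↭ ∷ O↭) = fromWord o o↭ ∷ fromWords O O↭

  map-permuteBy-fromWords : ∀ {A : Set a} (xs : Vec A n) O (O↭ : All (_↭ allFin n) O) →
    map (permuteBy xs) (fromWords O O↭) ≡ map (map (V.lookup xs)) O
  map-permuteBy-fromWords xs []      []         = refl
  map-permuteBy-fromWords xs (o ∷ O) (o↭ ∷ O↭) = cong₂ _∷_ permuteBy-o (map-permuteBy-fromWords xs O O↭)
    where
    permuteBy-o : permuteBy xs (fromWord o o↭) ≡ map (V.lookup xs) o
    permuteBy-o = trans (toList-tabulate _)
      (trans (sym (map-tabulate (fromWord o o↭ ⟨$⟩ʳ_) (V.lookup xs))) (cong (map (V.lookup xs)) (word-fromWord o o↭)))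

  occursOnce : ∀ σ O (O↭ : All (_↭ allFin n) O) → Unique O → word σ ∈ O → OccursOnce σ (fromWords O O↭)
  occursOnce σ O O↭ uO σ∈O = position O O↭ σ∈O , onlyPosition O O↭ uO
    where
    ≈σ⇒≡ : ∀ {o} (o↭ : o ↭ allFin n) → fromWord o o↭ ≈ σ → o ≡ word σ
    ≈σ⇒≡ {o} o↭ eq = trans (sym (word-fromWord o o↭)) (tabulate-cong eq)

    position : ∀ O O↭ → word σ ∈ O → Σ (Fin (length (fromWords O O↭))) (λ p → lookup (fromWords O O↭) p ≈ σ)
    position (o ∷ O) (o↭ ∷ O↭) (here refl) = zero , word-injective {fromWord (word σ) o↭} {σ} (word-fromWord (word σ) o↭)
    position (o ∷ O) (o↭ ∷ O↭) (there σ∈) with position O O↭ σ∈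
    ... | p , eq = suc p , eq

    ≈σ⇒∈ : ∀ O O↭ p → lookup (fromWords O O↭) p ≈ σ → word σ ∈ O
    ≈σ⇒∈ (o ∷ O) (o↭ ∷ O↭) zero    eq = here (sym (≈σ⇒≡ o↭ eq))
    ≈σ⇒∈ (o ∷ O) (o↭ ∷ O↭) (suc p) eq = there (≈σ⇒∈ O O↭ p eq)

    onlyPosition : ∀ O O↭ → Unique O → ∀ p q →
      lookup (fromWords O O↭) p ≈ σ → lookup (fromWords O O↭) q ≈ σ → p ≡ q
    onlyPosition (o ∷ O) (o↭ ∷ O↭) _          zero    zero    _   _   = refl
    onlyPosition (o ∷ O) (o↭ ∷ O↭) (o∉ ∷ _)  zero    (suc q) eqp eqq =
      ⊥-elim (All.lookup o∉ (≈σ⇒∈ O O↭ q eqq) (≈σ⇒≡ o↭ eqp))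
    onlyPosition (o ∷ O) (o↭ ∷ O↭) (o∉ ∷ _)  (suc p) zero    eqp eqq =
      ⊥-elim (All.lookup o∉ (≈σ⇒∈ O O↭ p eqp) (≈σ⇒≡ o↭ eqq))
    onlyPosition (o ∷ O) (o↭ ∷ O↭) (_ ∷ uO)  (suc p) (suc q) eqp eqq = cong suc (onlyPosition O O↭ uO p q eqp eqq)

mainTheorem3 : ∀ {a} {A : Set a} (n : ℕ) (xs : Vec A n) →
    length (proj₁ (Permutations (toList xs) 0)) ≡ n ! ×
    Σ (List (Permutation′ n)) (λ σs →
      proj₁ (Permutations (toList xs) 0) ≡ map (permuteBy xs) σs ×
      (∀ σ → OccursOnce σ σs))
mainTheorem3 n xs =
    trans (cong length outputs) (trans (length-map _ O) (trans (count R) (cong _! (length-tabulate {n = n} id))))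
  , fromWords O (sound R)
  , trans outputs (sym (map-permuteBy-fromWords xs O (sound R)))
  , λ σ → occursOnce σ O (sound R) (unique R (Unique.allFin⁺ n)) (complete R (word-↭ σ))
  where
  open Rearrangements
  O : List (List (Fin n))
  O = proj₁ (Permutations (allFin n) 0)
  R : Rearrangements (allFin n) O
  R = Permutations-rearrangements _ (allFin n) refl
  outputs : proj₁ (Permutations (toList xs) 0) ≡ map (map (V.lookup xs)) O
  outputs = cong proj₁ (trans (cong (λ L → Permutations L 0) (toList-allFin xs)) (Permutations-map (V.lookup xs) (allFin n)))
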